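{- Let $a\in\mathbb{N}$ with $a\geq 3$, and let $S(a)$ be the submonoid of $(\mathbb{N},+)$ generated by $\{f_a+f_n\mid n\in\mathbb{N}\}$. Then the Frobenius number of $S(a)$ is $\mathrm{F}(S(a))=\left\lfloor \frac{a-1}{2}\right\rfloor f_a-1$.
   Context: $\{f_n\}$ is the Fibonacci sequence ($f_0=0$, $f_1=1$, $f_{n+2}=f_{n+1}+f_n$). $S(a)$ is a numerical semigroup; its Frobenius number $\mathrm{F}(S(a))$ is the largest integer not belonging to $S(a)$. -}

module Defs where

open import Data.Nat using (ℕ; zero; suc; _+_; _<_)
open import Data.Product using (_×_; Σ)
open import Relation.Binary.PropositionalEquality using (_≡_)
open import Relation.Nullary using (¬_)

fib : ℕ → ℕ
fib zero = 0
fib (suc zero) = 1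
fib (suc (suc n)) = fib (suc n) + fib n

data Generated (G : ℕ → Set) : ℕ → Set where
  gen-zero : Generated G 0
  gen-base : ∀ {x} → G x → Generated G x
  gen-add  : ∀ {x y} → Generated G x → Generated G y → Generated G (x + y)

SGen : ℕ → ℕ → Set
SGen a x = Σ ℕ λ n → fib a + fib n ≡ x

S : ℕ → ℕ → Set
S a = Generated (SGen a)

IsFrobeniusNumber : (ℕ → Set) → ℕ → Set
IsFrobeniusNumber M F = ¬ M F × (∀ y → F < y → M y)

module Submission where

-- Write x = q f_a + r with r < f_a and let zeck r be the length of the Zeckendorf
-- representation of r.  Then x ∈ S(a) iff zeck r ≤ q: the Fibonacci summands of r,
-- padded with copies of f_0, pair up with q copies of f_a into generators.  Conversely
-- this condition survives addition because zeck is subadditive and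
-- zeck (r₁ + r₂ - f_a) ≤ zeck r₁ + zeck r₂ + 1 when the remainders wrap around; both
-- rest on adding a Fibonacci number f_i to r raising zeck by at most one, even when
-- r + f_i overflows some f_L > r and f_L is then subtracted.  Below f_a the maximum of zeck is
-- ⌊(a - 1)/2⌋, attained at f_a - 1, which yields the Frobenius number.

open import Defs
open import Data.Nat
  using ( ℕ; zero; suc; _+_; _*_; _∸_; _/_; _≤_; _<_; _≤′_; ≤′-refl; ≤′-step; z≤n; s≤s
        ; _≤?_; _<?_; NonZero; >-nonZero; >-nonZero⁻¹)
open import Data.Nat.Properties
open import Algebra.Properties.CommutativeSemigroup +-commutativeSemigroup
  using (interchange; x∙yz≈xz∙y; x∙yz≈yx∙z; xy∙z≈xz∙y; xy∙z≈zx∙y)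
open import Data.Nat.Induction using (<-rec)
open import Data.Nat.Divisibility using (n∣m*n)
open import Data.Nat.DivMod
  using (_%_; m≡m%n+[m/n]*n; m%n<n; m*n/n≡m; m<n⇒m/n≡0; /-monoˡ-≤; +-distrib-/-∣ˡ; m/n≡1+[m∸n]/n)
open import Data.Nat.Tactic.RingSolver using (solve-∀)
open import Data.Product using (Σ-syntax; _×_; _,_; proj₁; proj₂)
open import Data.Sum using (inj₁; inj₂)
open import Function using (_∘_)
open import Relation.Nullary using (¬_; Dec; yes; no; contradiction)
open import Relation.Binary.PropositionalEquality

fib-≤-suc : ∀ n → fib n ≤ fib (suc n)
fib-≤-suc zero    = z≤n
fib-≤-suc (suc n) = m≤m+n (fib (suc n)) (fib n)

suc-monotone⇒monotone : (f : ℕ → ℕ) → (∀ n → f n ≤ f (suc n)) → ∀ {m n} → m ≤ n → f m ≤ f n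
suc-monotone⇒monotone f f-≤-suc m≤n = mono′ (≤⇒≤′ m≤n)
  where
  mono′ : ∀ {m n} → m ≤′ n → f m ≤ f n
  mono′ ≤′-refl            = ≤-refl
  mono′ (≤′-step {n} m≤′n) = ≤-trans (mono′ m≤′n) (f-≤-suc n)

fib-mono-≤ : ∀ {m n} → m ≤ n → fib m ≤ fib n
fib-mono-≤ = suc-monotone⇒monotone fib fib-≤-suc

fib-suc-pos : ∀ n → 0 < fib (suc n)
fib-suc-pos zero    = s≤s z≤n
fib-suc-pos (suc n) = ≤-trans (fib-suc-pos n) (m≤m+n (fib (suc n)) (fib n))

n<fib[2+n] : ∀ n → n < fib (suc (suc n))
n<fib[2+n] zero          = s≤s z≤n
n<fib[2+n] (suc zero)    = s≤s (s≤s z≤n)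
n<fib[2+n] (suc (suc n)) =
  ≤-trans (s≤s (s≤s (m≤n+m (suc n) n))) (+-mono-≤ (n<fib[2+n] (suc n)) (n<fib[2+n] n))

split-at : ∀ a {r b} → a ≤ r → r < a + b → Σ[ r′ ∈ ℕ ] (r ≡ a + r′ × r′ < b)
split-at a {r} {b} a≤r r<a+b =
  r ∸ a , sym (m+[n∸m]≡n a≤r) , subst (r ∸ a <_) (m+n∸m≡n a b) (∸-monoˡ-< r<a+b a≤r)

-- zeckUpTo n r counts the summands the greedy algorithm takes from f_n, …, f_1
-- when writing r; once r < f_(n+1) this is the length of the Zeckendorf
-- representation of r, and r < f_(r+2) makes suc r always large enough.
zeckUpTo : ℕ → ℕ → ℕ
zeckUpTo zero    r = 0
zeckUpTo (suc n) r with fib (suc n) ≤? r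
... | yes _ = suc (zeckUpTo n (r ∸ fib (suc n)))
... | no  _ = zeckUpTo n r

zeck : ℕ → ℕ
zeck r = zeckUpTo (suc r) r

zeckUpTo-take : ∀ n {r} → fib (suc n) ≤ r → zeckUpTo (suc n) r ≡ suc (zeckUpTo n (r ∸ fib (suc n)))
zeckUpTo-take n {r} f≤r with fib (suc n) ≤? r
... | yes _   = refl
... | no  f≰r = contradiction f≤r f≰r

zeckUpTo-+ : ∀ k n {r} → r < fib (suc n) → zeckUpTo (k + n) r ≡ zeckUpTo n r
zeckUpTo-+ zero    n r<f = refl
zeckUpTo-+ (suc k) n {r} r<f with fib (suc (k + n)) ≤? r
... | yes f≤r = contradiction (≤-trans (fib-mono-≤ (s≤s (m≤n+m n k))) f≤r) (<⇒≱ r<f)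
... | no  _   = zeckUpTo-+ k n r<f

zeckUpTo-irrelevant : ∀ m n {r} → r < fib (suc m) → r < fib (suc n) → zeckUpTo m r ≡ zeckUpTo n r
zeckUpTo-irrelevant m n {r} r<fₘ r<fₙ with ≤-total m n
... | inj₁ m≤n = sym (trans (cong (λ t → zeckUpTo t r) (sym (m∸n+n≡m m≤n))) (zeckUpTo-+ (n ∸ m) m r<fₘ))
... | inj₂ n≤m = trans (cong (λ t → zeckUpTo t r) (sym (m∸n+n≡m n≤m))) (zeckUpTo-+ (m ∸ n) n r<fₙ)

zeck≡zeckUpTo : ∀ n {r} → r < fib (suc n) → zeck r ≡ zeckUpTo n r
zeck≡zeckUpTo n {r} = zeckUpTo-irrelevant (suc r) n (n<fib[2+n] r)

zeck-fib+ : ∀ p {r} → r < fib (suc p) → zeck (fib (suc (suc p)) + r) ≡ suc (zeck r)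
zeck-fib+ p {r} r<f = begin
  zeck (F + r)                       ≡⟨ zeck≡zeckUpTo (suc (suc p)) (+-monoʳ-< F r<f) ⟩
  zeckUpTo (suc (suc p)) (F + r)     ≡⟨ zeckUpTo-take (suc p) (m≤m+n F r) ⟩
  suc (zeckUpTo (suc p) (F + r ∸ F)) ≡⟨ cong (suc ∘ zeckUpTo (suc p)) (m+n∸m≡n F r) ⟩
  suc (zeckUpTo (suc p) r)           ≡⟨ cong suc (sym (zeck≡zeckUpTo (suc p) (≤-trans r<f (fib-≤-suc (suc p))))) ⟩
  suc (zeck r)                       ∎
  where
  open ≡-Reasoning
  F = fib (suc (suc p))

zeck≤zeck[fib+] : ∀ p {r} → r < fib (suc p) → zeck r ≤ zeck (fib (suc (suc p)) + r)
zeck≤zeck[fib+] p r<f = ≤-trans (n≤1+n _) (≤-reflexive (sym (zeck-fib+ p r<f)))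

data ZeckView : ℕ → Set where
  zeck-zero : ZeckView 0
  zeck-lead : ∀ p {r} → r < fib (suc p) → ZeckView (fib (suc (suc p)) + r)

fib-bracket : ∀ v → Σ[ p ∈ ℕ ] (fib (suc (suc p)) ≤ suc v × suc v < fib (suc (suc (suc p))))
fib-bracket zero = 0 , s≤s z≤n , s≤s (s≤s z≤n)
fib-bracket (suc v) with fib-bracket v
... | p , f≤v , v<f with suc (suc v) <? fib (suc (suc (suc p)))
...   | yes v+1<f = p , m≤n⇒m≤1+n f≤v , v+1<f
...   | no  v+1≮f = suc p , ≤-reflexive (sym v+1≡f) , subst (_< F + fib (suc (suc p))) (sym v+1≡f) (m<m+n F (fib-suc-pos (suc p)))
  where
  F = fib (suc (suc (suc p)))
  v+1≡f : suc (suc v) ≡ F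
  v+1≡f = ≤-antisym v<f (≮⇒≥ v+1≮f)

zeckView : ∀ r → ZeckView r
zeckView zero    = zeck-zero
zeckView (suc v) with fib-bracket v
... | p , f≤v , v<f with split-at (fib (suc (suc p))) f≤v v<f
... | r , v≡ , r<f = subst ZeckView (sym v≡) (zeck-lead p r<f)

zeck-fib≤1 : ∀ i → zeck (fib i) ≤ 1
zeck-fib≤1 zero          = z≤n
zeck-fib≤1 (suc zero)    = ≤-refl
zeck-fib≤1 (suc (suc p)) =
  ≤-reflexive (trans (cong zeck (sym (+-identityʳ (fib (suc (suc p)))))) (zeck-fib+ p (fib-suc-pos p)))

data Near (i n : ℕ) : Set where
  far-below  : ∀ k → n ≡ suc (suc (i + k)) → Near i n
  just-below : n ≡ suc i → Near i n
  equal      : i ≡ n → Near i n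
  just-above : i ≡ suc n → Near i n
  far-above  : ∀ k → i ≡ suc (suc (n + k)) → Near i n

near : ∀ i n → Near i n
near zero          zero          = equal refl
near zero          (suc zero)    = just-below refl
near zero          (suc (suc n)) = far-below n refl
near (suc zero)    zero          = just-above refl
near (suc (suc i)) zero          = far-above i refl
near (suc i)       (suc n) with near i n
... | far-below k eq = far-below k (cong suc eq)
... | just-below eq  = just-below (cong suc eq)
... | equal eq       = equal (cong suc eq)
... | just-above eq  = just-above (cong suc eq)
... | far-above k eq = far-above k (cong suc eq)

AddFib : ℕ → Set
AddFib r = ∀ i → zeck (r + fib i) ≤ suc (zeck r)

-- The carry case of AddFib: adding f_i to r < f_L overflows past f_L.
-- The two properties are proved together by strong induction on r.
AddSubFib : ℕ → Set
AddSubFib r = ∀ L i → r < fib L → i < L → fib L ≤ r + fib i → zeck (r + fib i ∸ fib L) ≤ suc (zeck r)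

addFib-lead : ∀ p {r} → r < fib (suc p) → AddFib r → AddSubFib r →
              ∀ i → zeck (fib (suc (suc p)) + r + fib i) ≤ suc (suc (zeck r))
addFib-lead p {r} r<f A B i = cases i (near i (suc (suc p)))
  where
  open ≤-Reasoning
  F = fib (suc (suc p))

  -- 2 f_(p+2) = f_(p+3) + f_p
  double-fib : ∀ g h r → (g + h) + r + (g + h) ≡ ((g + h) + g) + (h + r)
  double-fib = solve-∀

  cases : ∀ i → Near i (suc (suc p)) → zeck (F + r + fib i) ≤ suc (suc (zeck r))
  cases i (far-below k refl) with r + fib i <? fib (suc (i + k))
  ... | yes no-carry = begin
    zeck (F + r + fib i)   ≡⟨ cong zeck (+-assoc F r (fib i)) ⟩
    zeck (F + (r + fib i)) ≡⟨ zeck-fib+ (i + k) no-carry ⟩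
    suc (zeck (r + fib i)) ≤⟨ s≤s (A i) ⟩
    suc (suc (zeck r))     ∎
  ... | no carry = begin
    zeck (F + r + fib i)                      ≡⟨ cong zeck F+r+fᵢ≡ ⟩
    zeck (fib (suc (suc (suc (i + k)))) + w) ≡⟨ zeck-fib+ (suc (i + k)) w<f ⟩
    suc (zeck w)                              ≤⟨ s≤s (B (suc (i + k)) i r<f (s≤s (m≤m+n i k)) G≤) ⟩
    suc (suc (zeck r))                        ∎
    where
    G = fib (suc (i + k))
    G≤ : G ≤ r + fib i
    G≤ = ≮⇒≥ carry
    w = r + fib i ∸ G
    G+w≡ : G + w ≡ r + fib i
    G+w≡ = m+[n∸m]≡n G≤
    F+r+fᵢ≡ : F + r + fib i ≡ fib (suc (suc (suc (i + k)))) + w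
    F+r+fᵢ≡ = trans (+-assoc F r (fib i)) (trans (cong (F +_) (sym G+w≡)) (sym (+-assoc F G w)))
    w<f : w < fib (suc (suc (i + k)))
    w<f = begin-strict
      w        <⟨ +-cancelˡ-< G w (fib i) (subst (_< G + fib i) (sym G+w≡) (+-monoˡ-< (fib i) r<f)) ⟩
      fib i    ≤⟨ fib-mono-≤ (m≤n⇒m≤1+n (m≤n⇒m≤1+n (m≤m+n i k))) ⟩
      fib (suc (suc (i + k))) ∎
  cases i (just-below refl) = begin
    zeck (F + r + fib (suc p))        ≡⟨ cong zeck (xy∙z≈xz∙y F r (fib (suc p))) ⟩
    zeck (fib (suc (suc (suc p))) + r) ≡⟨ zeck-fib+ (suc p) (≤-trans r<f (fib-≤-suc (suc p))) ⟩
    suc (zeck r)                       ≤⟨ n≤1+n _ ⟩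
    suc (suc (zeck r))                 ∎
  cases i (equal refl) = begin
    zeck (F + r + F)                         ≡⟨ cong zeck (double-fib (fib (suc p)) (fib p) r) ⟩
    zeck (fib (suc (suc (suc p))) + (fib p + r)) ≡⟨ zeck-fib+ (suc p) fₚ+r<f ⟩
    suc (zeck (fib p + r))                   ≡⟨ cong (suc ∘ zeck) (+-comm (fib p) r) ⟩
    suc (zeck (r + fib p))                   ≤⟨ s≤s (A p) ⟩
    suc (suc (zeck r))                       ∎
    where
    fₚ+r<f : fib p + r < F
    fₚ+r<f = subst (fib p + r <_) (+-comm (fib p) (fib (suc p))) (+-monoʳ-< (fib p) r<f)
  cases i (just-above refl) = begin
    zeck (F + r + fib (suc (suc (suc p))))   ≡⟨ cong zeck (xy∙z≈zx∙y F r (fib (suc (suc (suc p))))) ⟩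
    zeck (fib (suc (suc (suc (suc p)))) + r) ≡⟨ zeck-fib+ (suc (suc p)) (≤-trans r<f (fib-mono-≤ (m≤n⇒m≤1+n (n≤1+n (suc p))))) ⟩
    suc (zeck r)                             ≤⟨ n≤1+n _ ⟩
    suc (suc (zeck r))                       ∎
  cases i (far-above k refl) = begin
    zeck (F + r + fib i)   ≡⟨ cong zeck (+-comm (F + r) (fib i)) ⟩
    zeck (fib i + (F + r)) ≡⟨ zeck-fib+ (suc (suc (p + k))) F+r<f ⟩
    suc (zeck (F + r))     ≡⟨ cong suc (zeck-fib+ p r<f) ⟩
    suc (suc (zeck r))     ∎
    where
    F+r<f : F + r < fib (suc (suc (suc (p + k))))
    F+r<f = <-≤-trans (+-monoʳ-< F r<f) (fib-mono-≤ (s≤s (s≤s (s≤s (m≤m+n p k)))))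

subFib-far : ∀ i k r → (∀ {s} → s < r → AddSubFib s) →
  r < fib (suc (suc (suc (i + k)))) → fib (suc (suc (suc (i + k)))) ≤ r + fib i →
  zeck (r + fib i ∸ fib (suc (suc (suc (i + k))))) ≤ suc (zeck r)
subFib-far i k r B r<f fL≤ = lead (split-at F₂ F₂≤r r<f)
  where
  open ≤-Reasoning
  F₂ = fib (suc (suc (i + k)))
  G  = fib (suc (i + k))
  F₂≤r : F₂ ≤ r
  F₂≤r = +-cancelʳ-≤ G F₂ r (≤-trans fL≤ (+-monoʳ-≤ r (fib-mono-≤ (m≤n⇒m≤1+n (m≤m+n i k)))))
  lead : Σ[ s ∈ ℕ ] (r ≡ F₂ + s × s < G) → zeck (r + fib i ∸ (F₂ + G)) ≤ suc (zeck r)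
  lead (s , refl , s<G) = begin
    zeck (F₂ + s + fib i ∸ (F₂ + G)) ≡⟨ cong zeck drop-F₂ ⟩
    zeck (s + fib i ∸ G)             ≤⟨ B (m<n+m s (fib-suc-pos (suc (i + k)))) (suc (i + k)) i s<G (s≤s (m≤m+n i k)) G≤ ⟩
    suc (zeck s)                     ≤⟨ s≤s (zeck≤zeck[fib+] (i + k) s<G) ⟩
    suc (zeck (F₂ + s))              ∎
    where
    drop-F₂ : F₂ + s + fib i ∸ (F₂ + G) ≡ s + fib i ∸ G
    drop-F₂ = trans (cong (_∸ (F₂ + G)) (+-assoc F₂ s (fib i))) ([m+n]∸[m+o]≡n∸o F₂ (s + fib i) G)
    G≤ : G ≤ s + fib i
    G≤ = +-cancelˡ-≤ F₂ G (s + fib i) (subst (F₂ + G ≤_) (+-assoc F₂ s (fib i)) fL≤)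

subFib-prev : ∀ q r → fib (suc (suc q)) ≤ r → r < fib (suc (suc (suc q))) →
  zeck (r + fib (suc q) ∸ fib (suc (suc (suc q)))) ≤ suc (zeck r)
subFib-prev q r F₂≤r r<f = lead (split-at F₂ F₂≤r r<f)
  where
  open ≤-Reasoning
  F₂ = fib (suc (suc q))
  G  = fib (suc q)
  lead : Σ[ s ∈ ℕ ] (r ≡ F₂ + s × s < G) → zeck (r + G ∸ (F₂ + G)) ≤ suc (zeck r)
  lead (s , refl , s<G) = begin
    zeck (F₂ + s + G ∸ (F₂ + G)) ≡⟨ cong zeck drop-F₂+G ⟩
    zeck s                       ≤⟨ zeck≤zeck[fib+] q s<G ⟩
    zeck (F₂ + s)                ≤⟨ n≤1+n _ ⟩
    suc (zeck (F₂ + s))          ∎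
    where
    drop-F₂+G : F₂ + s + G ∸ (F₂ + G) ≡ s
    drop-F₂+G = trans (cong (_∸ (F₂ + G)) (+-assoc F₂ s G)) (trans ([m+n]∸[m+o]≡n∸o F₂ (s + G) G) (m+n∸n≡m s G))

subFib-last : ∀ q r → (∀ {s} → s < r → AddFib s) →
  fib (suc q) ≤ r → r < fib (suc (suc (suc q))) → zeck (r ∸ fib (suc q)) ≤ suc (zeck r)
subFib-last q r A G≤r r<f with fib (suc (suc q)) ≤? r
... | yes F₂≤r = lead (split-at F₂ F₂≤r r<f)
  where
  open ≤-Reasoning
  F₂ = fib (suc (suc q))
  G  = fib (suc q)
  H  = fib q
  lead : Σ[ s ∈ ℕ ] (r ≡ F₂ + s × s < G) → zeck (r ∸ G) ≤ suc (zeck r)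
  lead (s , refl , s<G) = begin
    zeck (G + H + s ∸ G)   ≡⟨ cong (λ t → zeck (t ∸ G)) (+-assoc G H s) ⟩
    zeck (G + (H + s) ∸ G) ≡⟨ cong zeck (trans (m+n∸m≡n G (H + s)) (+-comm H s)) ⟩
    zeck (s + H)           ≤⟨ A (m<n+m s (fib-suc-pos (suc q))) q ⟩
    suc (zeck s)           ≤⟨ s≤s (zeck≤zeck[fib+] q s<G) ⟩
    suc (zeck (F₂ + s))    ∎
... | no F₂≰r = below-F₂ q r G≤r (≰⇒> F₂≰r)
  where
  below-F₂ : ∀ q r → fib (suc q) ≤ r → r < fib (suc (suc q)) → zeck (r ∸ fib (suc q)) ≤ suc (zeck r)
  below-F₂ zero     r 1≤r r<1 = contradiction 1≤r (<⇒≱ r<1)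
  below-F₂ (suc q′) r G≤r r<F₂ = lead (split-at G G≤r r<F₂)
    where
    open ≤-Reasoning
    G = fib (suc (suc q′))
    lead : Σ[ s ∈ ℕ ] (r ≡ G + s × s < fib (suc q′)) → zeck (r ∸ G) ≤ suc (zeck r)
    lead (s , refl , s<f) = begin
      zeck (G + s ∸ G) ≡⟨ cong zeck (m+n∸m≡n G s) ⟩
      zeck s           ≤⟨ zeck≤zeck[fib+] q′ s<f ⟩
      zeck (G + s)     ≤⟨ n≤1+n _ ⟩
      suc (zeck (G + s)) ∎

addSubFib : ∀ r → (∀ {s} → s < r → AddFib s × AddSubFib s) → AddSubFib r
addSubFib r       ih zero i ()
addSubFib (suc r) ih (suc zero)       i (s≤s ())
addSubFib (suc r) ih (suc (suc zero)) i (s≤s ())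
addSubFib zero ih (suc zero)       zero          _ _            ()
addSubFib zero ih (suc zero)       (suc i)       _ (s≤s ())     _
addSubFib zero ih (suc (suc zero)) zero          _ _            ()
addSubFib zero ih (suc (suc zero)) (suc zero)    _ _            _ = z≤n
addSubFib r    ih (suc (suc zero)) (suc (suc i)) _ (s≤s (s≤s ())) _
addSubFib r ih (suc (suc (suc q))) i r<f i<L fL≤ with near i (suc (suc q))
... | far-below k refl = subFib-far i k r (proj₂ ∘ ih) r<f fL≤
... | just-below refl  = subFib-prev q r (+-cancelʳ-≤ (fib (suc q)) (fib (suc (suc q))) r fL≤) r<f
... | equal refl       = subst (λ t → zeck t ≤ suc (zeck r)) (sym drop-F₂)
                           (subFib-last q r (proj₁ ∘ ih) G≤r r<f)
  where
  F₂ = fib (suc (suc q))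
  G  = fib (suc q)
  G≤r : G ≤ r
  G≤r = +-cancelˡ-≤ F₂ G r (subst (F₂ + G ≤_) (+-comm r F₂) fL≤)
  drop-F₂ : r + F₂ ∸ (F₂ + G) ≡ r ∸ G
  drop-F₂ = trans (cong (_∸ (F₂ + G)) (+-comm r F₂)) ([m+n]∸[m+o]≡n∸o F₂ r G)
... | just-above refl  = contradiction i<L (n≮n _)
... | far-above k refl = contradiction (s≤s (s≤s (s≤s (m≤n⇒m≤1+n (m≤m+n q k))))) (<⇒≱ i<L)

addFib : ∀ r → (∀ {s} → s < r → AddFib s × AddSubFib s) → AddFib r
addFib r ih i with zeckView r
... | zeck-zero = zeck-fib≤1 i
... | zeck-lead p {s} s<f = begin
  zeck (fib (suc (suc p)) + s + fib i) ≤⟨ addFib-lead p s<f (proj₁ IHₛ) (proj₂ IHₛ) i ⟩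
  suc (suc (zeck s))                   ≡⟨ cong suc (sym (zeck-fib+ p s<f)) ⟩
  suc (zeck (fib (suc (suc p)) + s))   ∎
  where
  open ≤-Reasoning
  IHₛ = ih (m<n+m s (fib-suc-pos (suc p)))

addFib×addSubFib : ∀ r → AddFib r × AddSubFib r
addFib×addSubFib = <-rec _ (λ r ih → addFib r ih , addSubFib r ih)

zeck-+fib : ∀ r i → zeck (r + fib i) ≤ suc (zeck r)
zeck-+fib r = proj₁ (addFib×addSubFib r)

zeck-+fib∸fib : ∀ r L i → r < fib L → i < L → fib L ≤ r + fib i → zeck (r + fib i ∸ fib L) ≤ suc (zeck r)
zeck-+fib∸fib r = proj₂ (addFib×addSubFib r)

zeck-subadditive : ∀ u v → zeck (u + v) ≤ zeck u + zeck v
zeck-subadditive u v = <-rec Subadditive step v u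
  where
  Subadditive : ℕ → Set
  Subadditive v = ∀ u → zeck (u + v) ≤ zeck u + zeck v
  step : ∀ v → (∀ {s} → s < v → Subadditive s) → Subadditive v
  step v ih u with zeckView v
  ... | zeck-zero = ≤-reflexive (trans (cong zeck (+-identityʳ u)) (sym (+-identityʳ (zeck u))))
  ... | zeck-lead p {s} s<f = begin
    zeck (u + (F + s))    ≡⟨ cong zeck (x∙yz≈xz∙y u F s) ⟩
    zeck (u + s + F)      ≤⟨ zeck-+fib (u + s) (suc (suc p)) ⟩
    suc (zeck (u + s))    ≤⟨ s≤s (ih (m<n+m s (fib-suc-pos (suc p))) u) ⟩
    suc (zeck u + zeck s) ≡⟨ sym (+-suc (zeck u) (zeck s)) ⟩
    zeck u + suc (zeck s) ≡⟨ cong (zeck u +_) (sym (zeck-fib+ p s<f)) ⟩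
    zeck u + zeck (F + s) ∎
    where
    open ≤-Reasoning
    F = fib (suc (suc p))

zeck-wrap : ∀ a {r₁ r₂} → r₁ < fib a → r₂ < fib a → fib a ≤ r₁ + r₂ →
            zeck (r₁ + r₂ ∸ fib a) ≤ suc (zeck r₁ + zeck r₂)
zeck-wrap a {r₁} {r₂} = <-rec Wrap step r₂ r₁
  where
  m = fib a
  Wrap : ℕ → Set
  Wrap r₂ = ∀ r₁ → r₁ < m → r₂ < m → m ≤ r₁ + r₂ → zeck (r₁ + r₂ ∸ m) ≤ suc (zeck r₁ + zeck r₂)
  step : ∀ r₂ → (∀ {s} → s < r₂ → Wrap s) → Wrap r₂
  step r₂ ih r₁ r₁<m r₂<m m≤r₁+r₂ with zeckView r₂
  ... | zeck-zero = contradiction (subst (m ≤_) (+-identityʳ r₁) m≤r₁+r₂) (<⇒≱ r₁<m)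
  ... | zeck-lead p {s} s<f with m ≤? r₁ + s
  ...   | yes m≤r₁+s = begin
    zeck (r₁ + (F + s) ∸ m)      ≡⟨ cong zeck (trans (cong (_∸ m) (x∙yz≈xz∙y r₁ F s)) (+-∸-comm F m≤r₁+s)) ⟩
    zeck (r₁ + s ∸ m + F)        ≤⟨ zeck-+fib (r₁ + s ∸ m) (suc (suc p)) ⟩
    suc (zeck (r₁ + s ∸ m))      ≤⟨ s≤s (ih s<r₂ r₁ r₁<m (<-trans s<r₂ r₂<m) m≤r₁+s) ⟩
    suc (suc (zeck r₁ + zeck s)) ≡⟨ cong suc (sym (+-suc (zeck r₁) (zeck s))) ⟩
    suc (zeck r₁ + suc (zeck s)) ≡⟨ cong (λ t → suc (zeck r₁ + t)) (sym (zeck-fib+ p s<f)) ⟩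
    suc (zeck r₁ + zeck (F + s)) ∎
    where
    open ≤-Reasoning
    F = fib (suc (suc p))
    s<r₂ : s < F + s
    s<r₂ = m<n+m s (fib-suc-pos (suc p))
  ...   | no m≰r₁+s = begin
    zeck (r₁ + (F + s) ∸ m)      ≡⟨ cong (λ t → zeck (t ∸ m)) (x∙yz≈xz∙y r₁ F s) ⟩
    zeck (r₁ + s + F ∸ m)        ≤⟨ zeck-+fib∸fib (r₁ + s) a (suc (suc p)) (≰⇒> m≰r₁+s) 2+p<a m≤r₁+s+F ⟩
    suc (zeck (r₁ + s))          ≤⟨ s≤s (zeck-subadditive r₁ s) ⟩
    suc (zeck r₁ + zeck s)       ≤⟨ s≤s (+-monoʳ-≤ (zeck r₁) (zeck≤zeck[fib+] p s<f)) ⟩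
    suc (zeck r₁ + zeck (F + s)) ∎
    where
    open ≤-Reasoning
    F = fib (suc (suc p))
    2+p<a : suc (suc p) < a
    2+p<a = ≰⇒> (λ a≤2+p → <⇒≱ r₂<m (≤-trans (fib-mono-≤ a≤2+p) (m≤m+n F s)))
    m≤r₁+s+F : m ≤ r₁ + s + F
    m≤r₁+s+F = subst (m ≤_) (x∙yz≈xz∙y r₁ F s) m≤r₁+r₂

zeckBound : ℕ → ℕ
zeckBound zero                = 0
zeckBound (suc zero)          = 0
zeckBound (suc (suc zero))    = 0
zeckBound (suc (suc (suc n))) = suc (zeckBound (suc n))

zeckBound-≤-suc : ∀ n → zeckBound n ≤ zeckBound (suc n)
zeckBound-≤-suc zero                = z≤n
zeckBound-≤-suc (suc zero)          = z≤n
zeckBound-≤-suc (suc (suc zero))    = z≤n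
zeckBound-≤-suc (suc (suc (suc n))) = s≤s (zeckBound-≤-suc (suc n))

zeckBound-mono-≤ : ∀ {m n} → m ≤ n → zeckBound m ≤ zeckBound n
zeckBound-mono-≤ = suc-monotone⇒monotone zeckBound zeckBound-≤-suc

zeck≤zeckBound : ∀ n {r} → r < fib n → zeck r ≤ zeckBound n
zeck≤zeckBound n {r} = <-rec Bounded step r n
  where
  Bounded : ℕ → Set
  Bounded r = ∀ n → r < fib n → zeck r ≤ zeckBound n
  step : ∀ r → (∀ {s} → s < r → Bounded s) → Bounded r
  step r ih n r<f with zeckView r
  ... | zeck-zero = z≤n
  ... | zeck-lead p {s} s<f = begin
    zeck (F + s)                  ≡⟨ zeck-fib+ p s<f ⟩
    suc (zeck s)                  ≤⟨ s≤s (ih (m<n+m s (fib-suc-pos (suc p))) (suc p) s<f) ⟩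
    zeckBound (suc (suc (suc p))) ≤⟨ zeckBound-mono-≤ 2+p<n ⟩
    zeckBound n                   ∎
    where
    open ≤-Reasoning
    F = fib (suc (suc p))
    2+p<n : suc (suc p) < n
    2+p<n = ≰⇒> (λ n≤2+p → <⇒≱ r<f (≤-trans (fib-mono-≤ n≤2+p) (m≤m+n F s)))

zeck[fib∸1]≡zeckBound : ∀ n → zeck (fib (suc n) ∸ 1) ≡ zeckBound (suc n)
zeck[fib∸1]≡zeckBound zero          = refl
zeck[fib∸1]≡zeckBound (suc zero)    = refl
zeck[fib∸1]≡zeckBound (suc (suc q)) = begin
  zeck (F₂ + G ∸ 1)   ≡⟨ cong zeck (+-∸-assoc F₂ (fib-suc-pos q)) ⟩
  zeck (F₂ + (G ∸ 1)) ≡⟨ zeck-fib+ q (∸-monoʳ-< {o = 0} (s≤s z≤n) (fib-suc-pos q)) ⟩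
  suc (zeck (G ∸ 1))  ≡⟨ cong suc (zeck[fib∸1]≡zeckBound q) ⟩
  suc (zeckBound (suc q)) ∎
  where
  open ≡-Reasoning
  F₂ = fib (suc (suc q))
  G  = fib (suc q)

[n∸1]/2≡zeckBound : ∀ n → (n ∸ 1) / 2 ≡ zeckBound n
[n∸1]/2≡zeckBound zero                = refl
[n∸1]/2≡zeckBound (suc zero)          = refl
[n∸1]/2≡zeckBound (suc (suc zero))    = refl
[n∸1]/2≡zeckBound (suc (suc (suc n))) =
  trans (m/n≡1+[m∸n]/n {suc (suc n)} {2} (s≤s (s≤s z≤n))) (cong suc ([n∸1]/2≡zeckBound (suc n)))

Reduced : ℕ → ℕ → Set
Reduced m x = Σ[ q ∈ ℕ ] Σ[ r ∈ ℕ ] (x ≡ q * m + r × r < m × zeck r ≤ q)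

Reduced-+ : ∀ a {x y} → Reduced (fib a) x → Reduced (fib a) y → Reduced (fib a) (x + y)
Reduced-+ a (q₁ , r₁ , refl , r₁<m , z₁≤q₁) (q₂ , r₂ , refl , r₂<m , z₂≤q₂) with r₁ + r₂ <? fib a
... | yes r₁+r₂<m = q₁ + q₂ , r₁ + r₂ , regroup , r₁+r₂<m , ≤-trans (zeck-subadditive r₁ r₂) (+-mono-≤ z₁≤q₁ z₂≤q₂)
  where
  m = fib a
  regroup : q₁ * m + r₁ + (q₂ * m + r₂) ≡ (q₁ + q₂) * m + (r₁ + r₂)
  regroup = trans (interchange (q₁ * m) r₁ (q₂ * m) r₂) (cong (_+ (r₁ + r₂)) (sym (*-distribʳ-+ m q₁ q₂)))
... | no r₁+r₂≮m = suc (q₁ + q₂) , t , carry , t<m , ≤-trans (zeck-wrap a r₁<m r₂<m m≤r₁+r₂) (s≤s (+-mono-≤ z₁≤q₁ z₂≤q₂))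
  where
  m = fib a
  m≤r₁+r₂ : m ≤ r₁ + r₂
  m≤r₁+r₂ = ≮⇒≥ r₁+r₂≮m
  t = r₁ + r₂ ∸ m
  m+t≡ : m + t ≡ r₁ + r₂
  m+t≡ = m+[n∸m]≡n m≤r₁+r₂
  carry : q₁ * m + r₁ + (q₂ * m + r₂) ≡ suc (q₁ + q₂) * m + t
  carry = begin
    q₁ * m + r₁ + (q₂ * m + r₂) ≡⟨ interchange (q₁ * m) r₁ (q₂ * m) r₂ ⟩
    q₁ * m + q₂ * m + (r₁ + r₂) ≡⟨ cong₂ _+_ (sym (*-distribʳ-+ m q₁ q₂)) (sym m+t≡) ⟩
    (q₁ + q₂) * m + (m + t)     ≡⟨ x∙yz≈yx∙z ((q₁ + q₂) * m) m t ⟩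
    suc (q₁ + q₂) * m + t       ∎
    where open ≡-Reasoning
  t<m : t < m
  t<m = +-cancelˡ-< m t m (subst (_< m + m) (sym m+t≡) (+-mono-< r₁<m r₂<m))

[q*m+r]/m≡q : ∀ q {m r} .{{_ : NonZero m}} → r < m → (q * m + r) / m ≡ q
[q*m+r]/m≡q q {m} {r} r<m = begin
  (q * m + r) / m   ≡⟨ +-distrib-/-∣ˡ r (n∣m*n q) ⟩
  q * m / m + r / m ≡⟨ cong₂ _+_ (m*n/n≡m q m) (m<n⇒m/n≡0 r<m) ⟩
  q + 0             ≡⟨ +-identityʳ q ⟩
  q                 ∎
  where open ≡-Reasoning

¬Reduced[suc*∸1] : ∀ {m} .{{_ : NonZero m}} k → k < zeck (m ∸ 1) → ¬ Reduced m (suc k * m ∸ 1)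
¬Reduced[suc*∸1] {m} k k<z (q , r , eq , r<m , zr≤q) = <⇒≱ (subst₂ _<_ (sym q≡k) (cong zeck (sym r≡m∸1)) k<z) zr≤q
  where
  m∸1<m : m ∸ 1 < m
  m∸1<m = ∸-monoʳ-< {o = 0} (s≤s z≤n) (>-nonZero⁻¹ m)
  q*m+r≡ : q * m + r ≡ k * m + (m ∸ 1)
  q*m+r≡ = trans (sym eq) (trans (+-∸-comm (k * m) (>-nonZero⁻¹ m)) (+-comm (m ∸ 1) (k * m)))
  q≡k : q ≡ k
  q≡k = trans (sym ([q*m+r]/m≡q q r<m)) (trans (cong (_/ m) q*m+r≡) ([q*m+r]/m≡q k m∸1<m))
  r≡m∸1 : r ≡ m ∸ 1
  r≡m∸1 = +-cancelˡ-≡ (k * m) r (m ∸ 1) (trans (cong (λ c → c * m + r) (sym q≡k)) q*m+r≡)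

zeck≤⇒S : ∀ a {r} c → zeck r ≤ c → S a (c * fib a + r)
zeck≤⇒S a {r} = <-rec InS step r
  where
  m = fib a
  InS : ℕ → Set
  InS r = ∀ c → zeck r ≤ c → S a (c * m + r)
  multiples : ∀ c → S a (c * m)
  multiples zero    = gen-zero
  multiples (suc c) = gen-add (gen-base (0 , +-identityʳ m)) (multiples c)
  step : ∀ r → (∀ {s} → s < r → InS s) → InS r
  step r ih c zr≤c with zeckView r
  ... | zeck-zero = subst (S a) (sym (+-identityʳ (c * m))) (multiples c)
  ... | zeck-lead p {s} s<f = lead c (subst (_≤ c) (zeck-fib+ p s<f) zr≤c)
    where
    F = fib (suc (suc p))
    lead : ∀ c → suc (zeck s) ≤ c → S a (c * m + (F + s))
    lead (suc c) (s≤s zs≤c) = subst (S a) (interchange m F (c * m) s)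
      (gen-add (gen-base (suc (suc p) , refl)) (ih (m<n+m s (fib-suc-pos (suc p))) c zs≤c))

module Frobenius (a′ : ℕ) where
  a = suc (suc (suc a′))
  m = fib a

  m>0 : 0 < m
  m>0 = fib-suc-pos (suc (suc a′))

  instance
    m≢0 : NonZero m
    m≢0 = >-nonZero m>0

  Reduced-m : Reduced m m
  Reduced-m = 1 , 0 , sym (trans (+-identityʳ (1 * m)) (*-identityˡ m)) , m>0 , z≤n

  Reduced-m+fib : ∀ n → n < a → Reduced m (m + fib n)
  Reduced-m+fib n n<a = 1 , fib n , cong (_+ fib n) (sym (*-identityˡ m)) , fₙ<m , zeck-fib≤1 n
    where
    fₙ<m : fib n < m
    fₙ<m = ≤-<-trans (fib-mono-≤ (≤-pred n<a)) (m<m+n (fib (suc (suc a′))) (fib-suc-pos a′))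

  Reduced-fib : ∀ i → Reduced m (fib (i + a))
  Reduced-fib zero          = Reduced-m
  Reduced-fib (suc zero)    = Reduced-m+fib (suc (suc a′)) ≤-refl
  Reduced-fib (suc (suc i)) = Reduced-+ a (Reduced-fib (suc i)) (Reduced-fib i)

  Reduced-generator : ∀ {x} → SGen a x → Reduced m x
  Reduced-generator (n , refl) with n <? a
  ... | yes n<a = Reduced-m+fib n n<a
  ... | no  n≮a = subst (λ k → Reduced m (m + fib k)) (m∸n+n≡m (≮⇒≥ n≮a))
                    (Reduced-+ a Reduced-m (Reduced-fib (n ∸ a)))

  S⇒Reduced : ∀ {x} → S a x → Reduced m x
  S⇒Reduced gen-zero      = 0 , 0 , refl , m>0 , z≤n
  S⇒Reduced (gen-base g)  = Reduced-generator g
  S⇒Reduced (gen-add x y) = Reduced-+ a (S⇒Reduced x) (S⇒Reduced y)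

  S-frobenius : IsFrobeniusNumber (S a) (zeckBound a * m ∸ 1)
  S-frobenius = (λ x∈S → ¬Reduced[suc*∸1] (zeckBound (suc a′)) k<z (S⇒Reduced x∈S)) , above
    where
    k<z : zeckBound (suc a′) < zeck (m ∸ 1)
    k<z = ≤-reflexive (sym (zeck[fib∸1]≡zeckBound (suc (suc a′))))
    above : ∀ y → zeckBound a * m ∸ 1 < y → S a y
    above y lt = subst (S a) (sym y≡) (zeck≤⇒S a (y / m) (≤-trans (zeck≤zeckBound a (m%n<n y m)) H≤y/m))
      where
      y≡ : y ≡ y / m * m + y % m
      y≡ = trans (m≡m%n+[m/n]*n y m) (+-comm (y % m) (y / m * m))
      H*m≤y : zeckBound a * m ≤ y
      H*m≤y = subst (_≤ y) (m+[n∸m]≡n (≤-trans m>0 (m≤m+n m _))) lt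
      H≤y/m : zeckBound a ≤ y / m
      H≤y/m = subst (_≤ y / m) (m*n/n≡m (zeckBound a) m) (/-monoˡ-≤ m H*m≤y)

theorem23 : (a : ℕ) → 3 ≤ a →
    IsFrobeniusNumber (S a) (((a ∸ 1) / 2) * fib a ∸ 1)
theorem23 (suc (suc (suc a′))) (s≤s (s≤s (s≤s z≤n))) =
  subst (λ k → IsFrobeniusNumber (S a) (k * fib a ∸ 1)) (sym ([n∸1]/2≡zeckBound a)) S-frobenius
  where open Frobenius a′
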